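{- Let $D=(\mathcal V,\mathcal A)$ be a digraph with a vertex $u$ such that $d^+(u)\ge 2$. Suppose $v_1,v_2$ are two distinct out-neighbours of $u$ and $S\subseteq\mathcal V$. If $e(v_1,S)+e(v_2,S)\ge |S|+2$, then $D$ is not $P_{2,2}$-free.
   Context: Digraphs are strict (no loops, no parallel arcs; opposite arcs $u\to w$, $w\to u$ allowed). $d^+(u)$ is the out-degree of $u$. For $x\in\mathcal V$ and $S\subseteq\mathcal V$, $e(x,S)$ is the number of arcs from $x$ to vertices of $S$. $P_{2,2}$ is the digraph on four distinct vertices $a,b,c,d$ with arcs $a\to b$, $b\to d$, $a\to c$, $c\to d$; $D$ is $P_{2,2}$-free if it contains no subdigraph isomorphic to $P_{2,2}$. -}

module Defs where

open import Data.Nat using (ℕ; _+_)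
open import Data.Bool using (Bool; true; false; _∧_)
open import Data.Fin using (Fin)
import Data.Fin as Fin
open import Data.Fin.Subset using (Subset; _∈_; ∣_∣)
open import Data.Vec.Functional using (Vector)
open import Data.Product using (Σ; ∃; _×_; _,_)
open import Relation.Binary.PropositionalEquality using (_≡_; _≢_)
open import Data.Vec using (lookup)
open import Relation.Nullary using (¬_)

-- Parallel arcs are impossible by
-- construction; opposite arcs u→w, w→u are allowed.
record Digraph (n : ℕ) : Set where
  field
    arc      : Fin n → Fin n → Bool
    loopless : ∀ v → arc v v ≡ false
open Digraph public

_⟶[_]_ : ∀ {n} → Fin n → Digraph n → Fin n → Set
u ⟶[ D ] w = arc D u w ≡ true

b2n : Bool → ℕ
b2n true  = 1
b2n false = 0

count : ∀ {n} → (Fin n → Bool) → ℕ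
count {ℕ.zero}  f = 0
count {ℕ.suc n} f = b2n (f Fin.zero) + count {n} (λ i → f (Fin.suc i))

outdeg : ∀ {n} → Digraph n → Fin n → ℕ
outdeg D u = count (arc D u)

e : ∀ {n} → Digraph n → Fin n → Subset n → ℕ
e D x S = count (λ y → arc D x y ∧ lookup S y)

ContainsP22 : ∀ {n} → Digraph n → Set
ContainsP22 {n} D =
  Σ (Fin n) λ a → Σ (Fin n) λ b → Σ (Fin n) λ c → Σ (Fin n) λ d →
    (a ≢ b) × (a ≢ c) × (a ≢ d) × (b ≢ c) × (b ≢ d) × (c ≢ d) ×
    (a ⟶[ D ] b) × (b ⟶[ D ] d) × (a ⟶[ D ] c) × (c ⟶[ D ] d)

P22-free : ∀ {n} → Digraph n → Set
P22-free D = ¬ ContainsP22 D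

module Submission where

-- Write N(v₁,v₂,S) for the set of common out-neighbours of v₁
-- and v₂ inside S.  Counting pointwise, every vertex y contributes at most
-- [y ∈ S] + [y ∈ N(v₁,v₂,S)] to e(v₁,S) + e(v₂,S) (an inclusion–exclusion
-- inequality), so e(v₁,S) + e(v₂,S) ≤ |S| + |N(v₁,v₂,S)|.  The hypothesis
-- therefore gives |N(v₁,v₂,S)| ≥ 2, hence a common out-neighbour d of v₁, v₂
-- different from u.  Then u → v₁ → d, u → v₂ → d is a copy of P₂,₂: the
-- four vertices are distinct because D has no loops, v₁ ≢ v₂ and d ≢ u.

open import Defs
open import Data.Nat using (ℕ; zero; suc; _+_; _≤_; z≤n; s≤s)
open import Data.Nat.Properties
  using (≤-refl; ≤-trans; +-mono-≤; +-cancelˡ-≤; +-commutativeSemigroup; module ≤-Reasoning)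
open import Data.Bool using (Bool; true; false; _∧_)
open import Data.Fin using (Fin)
import Data.Fin as Fin
open import Data.Fin.Subset using (Subset; ∣_∣)
open import Data.Vec using ([]; _∷_; lookup)
open import Data.Product using (Σ; _×_; _,_)
open import Relation.Binary.PropositionalEquality
  using (_≡_; _≢_; refl; sym; trans; cong)
open import Relation.Nullary using (¬_)
open import Algebra.Properties.CommutativeSemigroup +-commutativeSemigroup
  using (interchange)

count-pointwise-≤ : ∀ {n} (f g h k : Fin n → Bool) →
  (∀ i → b2n (f i) + b2n (g i) ≤ b2n (h i) + b2n (k i)) →
  count f + count g ≤ count h + count k
count-pointwise-≤ {zero}  f g h k le = z≤n
count-pointwise-≤ {suc n} f g h k le = begin
  (b2n (f 0F) + count (f ∘suc)) + (b2n (g 0F) + count (g ∘suc))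
    ≡⟨ interchange (b2n (f 0F)) _ _ _ ⟩
  (b2n (f 0F) + b2n (g 0F)) + (count (f ∘suc) + count (g ∘suc))
    ≤⟨ +-mono-≤ (le 0F)
         (count-pointwise-≤ (f ∘suc) (g ∘suc) (h ∘suc) (k ∘suc) (λ i → le (Fin.suc i))) ⟩
  (b2n (h 0F) + b2n (k 0F)) + (count (h ∘suc) + count (k ∘suc))
    ≡⟨ interchange (b2n (h 0F)) _ _ _ ⟩
  (b2n (h 0F) + count (h ∘suc)) + (b2n (k 0F) + count (k ∘suc)) ∎
  where
  open ≤-Reasoning
  0F = Fin.zero
  _∘suc : (Fin (suc n) → Bool) → Fin n → Bool
  (p ∘suc) i = p (Fin.suc i)

b2n-inclusion-exclusion : ∀ p q r →
  b2n (p ∧ r) + b2n (q ∧ r) ≤ b2n r + b2n (p ∧ (q ∧ r))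
b2n-inclusion-exclusion true  true  true  = ≤-refl
b2n-inclusion-exclusion true  false true  = s≤s z≤n
b2n-inclusion-exclusion false true  true  = s≤s z≤n
b2n-inclusion-exclusion false false true  = z≤n
b2n-inclusion-exclusion true  true  false = z≤n
b2n-inclusion-exclusion true  false false = z≤n
b2n-inclusion-exclusion false true  false = z≤n
b2n-inclusion-exclusion false false false = z≤n

count-inclusion-exclusion : ∀ {n} (p q r : Fin n → Bool) →
  count (λ y → p y ∧ r y) + count (λ y → q y ∧ r y)
    ≤ count r + count (λ y → p y ∧ (q y ∧ r y))
count-inclusion-exclusion p q r =
  count-pointwise-≤ _ _ _ _ (λ i → b2n-inclusion-exclusion (p i) (q i) (r i))

∣∣≡count-lookup : ∀ {n} (S : Subset n) → ∣ S ∣ ≡ count (lookup S)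
∣∣≡count-lookup []          = refl
∣∣≡count-lookup (true ∷ S)  = cong suc (∣∣≡count-lookup S)
∣∣≡count-lookup (false ∷ S) = ∣∣≡count-lookup S

count-witness : ∀ {n} (h : Fin n → Bool) → 1 ≤ count h →
  Σ (Fin n) λ d → h d ≡ true
count-witness {suc n} h pos with h Fin.zero in eq
... | true  = Fin.zero , eq
... | false with count-witness (λ i → h (Fin.suc i)) pos
...   | d , hd = Fin.suc d , hd

count-witness-avoiding : ∀ {n} (h : Fin n → Bool) (u : Fin n) → 2 ≤ count h →
  Σ (Fin n) λ d → (d ≢ u) × (h d ≡ true)
count-witness-avoiding {suc n} h Fin.zero two
  with count-witness (λ i → h (Fin.suc i)) (rest-pos (h Fin.zero) two)
  where
  rest-pos : ∀ b {c} → 2 ≤ b2n b + c → 1 ≤ c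
  rest-pos true  (s≤s le) = le
  rest-pos false le       = ≤-trans (s≤s z≤n) le
... | d , hd = Fin.suc d , (λ ()) , hd
count-witness-avoiding {suc n} h (Fin.suc u) two with h Fin.zero in eq
... | true  = Fin.zero , (λ ()) , eq
... | false with count-witness-avoiding (λ i → h (Fin.suc i)) u two
...   | d , d≢u , hd = Fin.suc d , (λ { refl → d≢u refl }) , hd

∧-trueˡ : ∀ {a b} → a ∧ b ≡ true → a ≡ true
∧-trueˡ {true} _ = refl

∧-trueʳ : ∀ {a b} → a ∧ b ≡ true → b ≡ true
∧-trueʳ {true} ab = ab

arc⇒≢ : ∀ {n} (D : Digraph n) {x y : Fin n} → x ⟶[ D ] y → x ≢ y
arc⇒≢ D {x} x⟶x refl with trans (sym x⟶x) (loopless D x)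
... | ()

common-out-in : ∀ {n} → Digraph n → Fin n → Fin n → Subset n → Fin n → Bool
common-out-in D v₁ v₂ S y = arc D v₁ y ∧ (arc D v₂ y ∧ lookup S y)

e-sum≤size+common : ∀ {n} (D : Digraph n) (v₁ v₂ : Fin n) (S : Subset n) →
  e D v₁ S + e D v₂ S ≤ ∣ S ∣ + count (common-out-in D v₁ v₂ S)
e-sum≤size+common D v₁ v₂ S
  rewrite ∣∣≡count-lookup S = count-inclusion-exclusion (arc D v₁) (arc D v₂) (lookup S)

P22-from-common-out-neighbour : ∀ {n} (D : Digraph n) {u v₁ v₂ d : Fin n} →
  v₁ ≢ v₂ → d ≢ u → u ⟶[ D ] v₁ → u ⟶[ D ] v₂ → v₁ ⟶[ D ] d → v₂ ⟶[ D ] d →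
  ContainsP22 D
P22-from-common-out-neighbour D {u} {v₁} {v₂} {d} v₁≢v₂ d≢u u⟶v₁ u⟶v₂ v₁⟶d v₂⟶d =
  u , v₁ , v₂ , d ,
  arc⇒≢ D u⟶v₁ , arc⇒≢ D u⟶v₂ , (λ u≡d → d≢u (sym u≡d)) ,
  v₁≢v₂ , arc⇒≢ D v₁⟶d , arc⇒≢ D v₂⟶d ,
  u⟶v₁ , v₁⟶d , u⟶v₂ , v₂⟶d

lemma3p3 : ∀ {n} (D : Digraph n) (u : Fin n) → 2 ≤ outdeg D u →
    (v₁ v₂ : Fin n) → v₁ ≢ v₂ → u ⟶[ D ] v₁ → u ⟶[ D ] v₂ →
    (S : Subset n) → ∣ S ∣ + 2 ≤ e D v₁ S + e D v₂ S →
    ¬ P22-free D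
lemma3p3 D u _ v₁ v₂ v₁≢v₂ u⟶v₁ u⟶v₂ S large free
  with count-witness-avoiding (common-out-in D v₁ v₂ S) u two-common
  where
  two-common : 2 ≤ count (common-out-in D v₁ v₂ S)
  two-common = +-cancelˡ-≤ ∣ S ∣ _ _ (≤-trans large (e-sum≤size+common D v₁ v₂ S))
... | d , d≢u , d-common =
  free (P22-from-common-out-neighbour D v₁≢v₂ d≢u u⟶v₁ u⟶v₂
          (∧-trueˡ d-common) (∧-trueˡ (∧-trueʳ {arc D v₁ d} d-common)))
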